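{- Let $H=(V,E)$ be an oriented hypergraph, with integer coefficients. (i) $\mathcal C=\mathcal B^\perp$. (ii) If $H$ has an algebraic spanning tree over the integers, then $\mathcal B=\mathcal C^\perp$.
   Context: An oriented hypergraph $H=(V,E)$ consists of a finite set $V$ and a set $E$ of ordered pairs $(A,B)$ of disjoint subsets of $V$, where $E$ never contains both $(A,B)$ and $(B,A)$. $C_0,C_1$ are the free $\mathbb Z$-modules with bases $V,E$; $\partial_1\colon C_1\to C_0$ is the linear extension of $(A,B)\mapsto\sum_{v\in B}v-\sum_{v\in A}v$; $C^0=\mathrm{Hom}(C_0,\mathbb Z)$, $C^1=\mathrm{Hom}(C_1,\mathbb Z)$; $\delta^0(\varphi)=\varphi\circ\partial_1$; $\gamma_1\colon C_1\to C^1$ with $\gamma_1(e)(e')=\delta_{ee'}$; $\langle\,,\rangle$ is the bilinear form on $C_1$ with $\langle e,e'\rangle=\delta_{ee'}$. $\mathcal C:=\operatorname{Ker}\partial_1$, $\mathcal B:=\gamma_1^{ -1}(\operatorname{Im}\delta^0)$, and for $X\subseteq C_1$, $X^\perp:=\{y\in C_1:\langle x,y\rangle=0\ \forall x\in X\}$. $T\subseteq E$ is an algebraic spanning tree over the integers if (1) $\mathcal B$ has a $\mathbb Z$-basis $(x_t\mid t\in T)$ with $\langle x_t,t'\rangle=\delta_{tt'}$ for all $t,t'\in T$, and (2) $\mathcal C$ has a $\mathbb Z$-basis $(x_e\mid e\in E\setminus T)$ with $\langle x_e,e'\rangle=\delta_{ee'}$ for all $e,e'\in E\setminus T$. -}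

module Defs where

open import Data.Nat using (ℕ; zero; suc)
open import Data.Fin using (Fin; zero; suc)
open import Data.Fin.Subset using (Subset; _∈_; _∉_)
open import Data.Vec using (lookup)
open import Data.Bool using (Bool; true; false; if_then_else_)
open import Data.Integer using (ℤ; _+_; _-_; _*_; 0ℤ; 1ℤ)
open import Data.Product using (Σ; _×_; _,_; ∃)
open import Data.Empty using (⊥)
open import Relation.Binary.PropositionalEquality using (_≡_)

Σ[<_]_ : (k : ℕ) → (Fin k → ℤ) → ℤ
Σ[< zero ] f = 0ℤ
Σ[< suc k ] f = f zero + Σ[< k ] (λ i → f (suc i))

𝟙 : ∀ {n} → Subset n → Fin n → ℤ
𝟙 S v = if lookup S v then 1ℤ else 0ℤ

-- Oriented hypergraph on vertex set V = Fin n with m edges E = Fin m;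
-- edge e is the ordered pair (tail e , head e) = (A , B).
record OrientedHypergraph (n m : ℕ) : Set where
  field
    tail head : Fin m → Subset n
    disjoint  : ∀ e v → v ∈ tail e → v ∈ head e → ⊥
    -- E is a set of pairs: distinct edges are distinct pairs
    distinct  : ∀ e e' → tail e ≡ tail e' → head e ≡ head e' → e ≡ e'
    noReverse : ∀ e e' → tail e ≡ head e' → head e ≡ tail e' → ⊥

C₀ : ℕ → Set
C₀ n = Fin n → ℤ

C₁ : ℕ → Set
C₁ m = Fin m → ℤ

_≐_ : ∀ {k} → (Fin k → ℤ) → (Fin k → ℤ) → Set
x ≐ y = ∀ i → x i ≡ y i

module _ {n m : ℕ} (H : OrientedHypergraph n m) where
  open OrientedHypergraph H

  -- coefficient of v in ∂₁ e = Σ_{v∈B} v − Σ_{v∈A} v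
  incidence : Fin m → Fin n → ℤ
  incidence e v = 𝟙 (head e) v - 𝟙 (tail e) v

  ∂₁ : C₁ m → C₀ n
  ∂₁ x v = Σ[< m ] (λ e → x e * incidence e v)

  -- δ⁰ φ = φ ∘ ∂₁, evaluated on the basis edge e
  δ⁰ : (Fin n → ℤ) → (Fin m → ℤ)
  δ⁰ φ e = Σ[< n ] (λ v → φ v * incidence e v)

  𝒞 : C₁ m → Set
  𝒞 x = ∂₁ x ≐ (λ _ → 0ℤ)

  -- ℬ = γ₁⁻¹ (Im δ⁰); γ₁ x is the functional with γ₁ x (e) = x e
  ℬ : C₁ m → Set
  ℬ x = ∃ λ (φ : Fin n → ℤ) → x ≐ δ⁰ φ

⟨_,_⟩ : ∀ {m} → C₁ m → C₁ m → ℤ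
⟨ x , y ⟩ = Σ[< _ ] (λ e → x e * y e)

_⊥ : ∀ {m} → (C₁ m → Set) → (C₁ m → Set)
(X ⊥) y = ∀ x → X x → ⟨ x , y ⟩ ≡ 0ℤ

edge : ∀ {m} → Fin m → C₁ m
edge e e' = if Data.Fin._≟_ e e' .Relation.Nullary.Decidable.does then 1ℤ else 0ℤ
  where import Data.Fin
        import Relation.Nullary.Decidable

δ : ∀ {m} → Fin m → Fin m → ℤ
δ = edge

-- The family is given as x : Fin m → C₁ m, only entries with index in I used;
-- linear combinations use coefficients c supported on I.
IsZBasis : ∀ {m} → (C₁ m → Set) → Subset m → (Fin m → C₁ m) → Set
IsZBasis {m} P I x =
    (∀ i → i ∈ I → P (x i))
  × (∀ y → P y → ∃ λ (c : Fin m → ℤ) →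
        (∀ i → i ∉ I → c i ≡ 0ℤ) × (y ≐ (λ e → Σ[< m ] (λ i → c i * x i e))))
  × (∀ (c : Fin m → ℤ) → (∀ i → i ∉ I → c i ≡ 0ℤ) →
        (λ e → Σ[< m ] (λ i → c i * x i e)) ≐ (λ _ → 0ℤ) →
        ∀ i → i ∈ I → c i ≡ 0ℤ)

IsAlgebraicSpanningTree : ∀ {n m} → OrientedHypergraph n m → Subset m → Set
IsAlgebraicSpanningTree {n} {m} H T =
    (∃ λ (x : Fin m → C₁ m) → IsZBasis (ℬ H) T x ×
        (∀ t t' → t ∈ T → t' ∈ T → ⟨ x t , edge t' ⟩ ≡ δ t t'))
  × (∃ λ (x : Fin m → C₁ m) → IsZBasis (𝒞 H) (Data.Fin.Subset.∁ T) x ×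
        (∀ e e' → e ∉ T → e' ∉ T → ⟨ x e , edge e' ⟩ ≡ δ e e'))
  where import Data.Fin.Subset

_≗ₛ_ : ∀ {m} → (C₁ m → Set) → (C₁ m → Set) → Set
P ≗ₛ Q = ∀ y → (P y → Q y) × (Q y → P y)

-- The pairing of δ⁰φ with a 1-chain y equals the pairing of φ with ∂₁y, so δ⁰ is
-- the transpose of ∂₁; testing against indicator 0-cochains turns ℬ^⊥ into Ker ∂₁.
-- For (ii), ℬ ⊆ 𝒞^⊥ follows from (i) by symmetry of ⟨ , ⟩. Conversely, given
-- y ∈ 𝒞^⊥, the element b = Σ_{t∈T} y_t x_t of ℬ agrees with y on T, so z = y − b
-- lies in 𝒞^⊥ and vanishes on T; pairing z with the family (x_e | e ∉ T) of 𝒞 then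
-- reads off z_e = 0 for e ∉ T.
module Submission where

open import Defs
open import Data.Nat using (ℕ; zero; suc)
open import Data.Fin using (Fin; zero; suc)
open import Data.Fin.Subset using (Subset; _∈_; _∉_)
open import Data.Fin.Subset.Properties using (_∈?_; x∉p⇒x∈∁p)
open import Data.Integer using (ℤ; _+_; _-_; _*_; -_; 0ℤ; 1ℤ; -1ℤ)
open import Data.Integer.Properties
  using ( +-*-semiring; +-identityˡ; +-identityʳ; +-inverseʳ; *-identityʳ
        ; *-zeroˡ; *-zeroʳ; *-comm; *-assoc; *-distribˡ-+; neg-distribʳ-*
        ; -1*i≡-i; i-j≡0⇒i≡j )
open import Algebra.Properties.Semiring.Sum +-*-semiring
  using (sum; sum-cong-≗; ∑-distrib-+; ∑-comm; *-distribˡ-sum; *-distribʳ-sum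
        ; sum-replicate-zero)
open import Data.Empty using (⊥-elim)
open import Data.Product using (_×_; ∃; _,_; proj₁; proj₂)
open import Function using (_∘_)
open import Relation.Binary.PropositionalEquality
  using (_≡_; _≢_; refl; sym; trans; cong; cong₂; module ≡-Reasoning)
open import Relation.Nullary using (yes; no)

open ≡-Reasoning

Σ≡sum : ∀ k (f : Fin k → ℤ) → Σ[< k ] f ≡ sum f
Σ≡sum zero    f = refl
Σ≡sum (suc k) f = cong (f zero +_) (Σ≡sum k (f ∘ suc))

Σ-cong : ∀ k {f g : Fin k → ℤ} → (∀ i → f i ≡ g i) → Σ[< k ] f ≡ Σ[< k ] g
Σ-cong k {f} {g} f≗g = begin
  Σ[< k ] f  ≡⟨ Σ≡sum k f ⟩
  sum f      ≡⟨ sum-cong-≗ f≗g ⟩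
  sum g      ≡⟨ Σ≡sum k g ⟨
  Σ[< k ] g  ∎

Σ-zero : ∀ k {f : Fin k → ℤ} → (∀ i → f i ≡ 0ℤ) → Σ[< k ] f ≡ 0ℤ
Σ-zero k f≗0 = trans (Σ-cong k f≗0) (trans (Σ≡sum k _) (sum-replicate-zero k))

Σ-distrib-+ : ∀ k (f g : Fin k → ℤ) →
              Σ[< k ] (λ i → f i + g i) ≡ Σ[< k ] f + Σ[< k ] g
Σ-distrib-+ k f g = begin
  Σ[< k ] (λ i → f i + g i)  ≡⟨ Σ≡sum k _ ⟩
  sum (λ i → f i + g i)      ≡⟨ ∑-distrib-+ f g ⟩
  sum f + sum g              ≡⟨ cong₂ _+_ (Σ≡sum k f) (Σ≡sum k g) ⟨
  Σ[< k ] f + Σ[< k ] g      ∎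

Σ-*ˡ : ∀ k c (f : Fin k → ℤ) → Σ[< k ] (λ i → c * f i) ≡ c * Σ[< k ] f
Σ-*ˡ k c f = begin
  Σ[< k ] (λ i → c * f i)  ≡⟨ Σ≡sum k _ ⟩
  sum (λ i → c * f i)      ≡⟨ *-distribˡ-sum c f ⟨
  c * sum f                ≡⟨ cong (c *_) (Σ≡sum k f) ⟨
  c * Σ[< k ] f            ∎

Σ-*ʳ : ∀ k c (f : Fin k → ℤ) → Σ[< k ] (λ i → f i * c) ≡ Σ[< k ] f * c
Σ-*ʳ k c f = begin
  Σ[< k ] (λ i → f i * c)  ≡⟨ Σ≡sum k _ ⟩
  sum (λ i → f i * c)      ≡⟨ *-distribʳ-sum c f ⟨
  sum f * c                ≡⟨ cong (_* c) (Σ≡sum k f) ⟨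
  Σ[< k ] f * c            ∎

Σ-neg : ∀ k (f : Fin k → ℤ) → Σ[< k ] (λ i → - f i) ≡ - Σ[< k ] f
Σ-neg k f = begin
  Σ[< k ] (λ i → - f i)    ≡⟨ Σ-cong k (λ i → -1*i≡-i (f i)) ⟨
  Σ[< k ] (λ i → -1ℤ * f i) ≡⟨ Σ-*ˡ k -1ℤ f ⟩
  -1ℤ * Σ[< k ] f           ≡⟨ -1*i≡-i _ ⟩
  - Σ[< k ] f               ∎

Σ-comm : ∀ k l (f : Fin k → Fin l → ℤ) →
         Σ[< k ] (λ i → Σ[< l ] (f i)) ≡ Σ[< l ] (λ j → Σ[< k ] (λ i → f i j))
Σ-comm k l f = begin
  Σ[< k ] (λ i → Σ[< l ] (f i))              ≡⟨ Σ-cong k (λ i → Σ≡sum l (f i)) ⟩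
  Σ[< k ] (λ i → sum (f i))                  ≡⟨ Σ≡sum k _ ⟩
  sum (λ i → sum (f i))                      ≡⟨ ∑-comm f ⟩
  sum (λ j → sum (λ i → f i j))              ≡⟨ Σ≡sum l _ ⟨
  Σ[< l ] (λ j → sum (λ i → f i j))          ≡⟨ Σ-cong l (λ j → Σ≡sum k _) ⟨
  Σ[< l ] (λ j → Σ[< k ] (λ i → f i j))      ∎

edge-offdiag : ∀ {k} (i j : Fin k) → i ≢ j → edge i j ≡ 0ℤ
edge-offdiag zero    zero    i≢j = ⊥-elim (i≢j refl)
edge-offdiag zero    (suc j) _   = refl
edge-offdiag (suc i) zero    _   = refl
edge-offdiag (suc i) (suc j) i≢j = edge-offdiag i j (i≢j ∘ cong suc)

edge-sym : ∀ {k} (i j : Fin k) → edge i j ≡ edge j i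
edge-sym zero    zero    = refl
edge-sym zero    (suc j) = refl
edge-sym (suc i) zero    = refl
edge-sym (suc i) (suc j) = edge-sym i j

⟨-,edge⟩ : ∀ {k} (x : C₁ k) j → ⟨ x , edge j ⟩ ≡ x j
⟨-,edge⟩ {suc k} x zero = begin
  x zero * 1ℤ + Σ[< k ] (λ i → x (suc i) * 0ℤ)  ≡⟨ cong₂ _+_ (*-identityʳ (x zero))
                                                      (Σ-zero k (λ i → *-zeroʳ (x (suc i)))) ⟩
  x zero + 0ℤ                                   ≡⟨ +-identityʳ (x zero) ⟩
  x zero                                        ∎
⟨-,edge⟩ {suc k} x (suc j) = begin
  x zero * 0ℤ + ⟨ x ∘ suc , edge j ⟩  ≡⟨ cong₂ _+_ (*-zeroʳ (x zero)) (⟨-,edge⟩ (x ∘ suc) j) ⟩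
  0ℤ + x (suc j)                     ≡⟨ +-identityˡ (x (suc j)) ⟩
  x (suc j)                          ∎

⟨⟩-comm : ∀ {k} (x y : C₁ k) → ⟨ x , y ⟩ ≡ ⟨ y , x ⟩
⟨⟩-comm x y = Σ-cong _ (λ e → *-comm (x e) (y e))

⟨edge,-⟩ : ∀ {k} j (x : C₁ k) → ⟨ edge j , x ⟩ ≡ x j
⟨edge,-⟩ j x = trans (⟨⟩-comm (edge j) x) (⟨-,edge⟩ x j)

⟨⟩-distrib-- : ∀ {k} (x y z : C₁ k) → ⟨ x , (λ e → y e - z e) ⟩ ≡ ⟨ x , y ⟩ - ⟨ x , z ⟩
⟨⟩-distrib-- {k} x y z = begin
  Σ[< k ] (λ e → x e * (y e - z e))          ≡⟨ Σ-cong k distrib ⟩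
  Σ[< k ] (λ e → x e * y e + - (x e * z e))  ≡⟨ Σ-distrib-+ k _ _ ⟩
  ⟨ x , y ⟩ + Σ[< k ] (λ e → - (x e * z e))  ≡⟨ cong (⟨ x , y ⟩ +_) (Σ-neg k _) ⟩
  ⟨ x , y ⟩ - ⟨ x , z ⟩                      ∎
  where
  distrib : ∀ e → x e * (y e - z e) ≡ x e * y e + - (x e * z e)
  distrib e = trans (*-distribˡ-+ (x e) (y e) (- z e))
                    (cong (x e * y e +_) (sym (neg-distribʳ-* (x e) (z e))))

⊥-closed-- : ∀ {k} (X : C₁ k → Set) {y z : C₁ k} →
             (X ⊥) y → (X ⊥) z → (X ⊥) (λ e → y e - z e)
⊥-closed-- X {y} {z} y⊥ z⊥ x x∈X = begin
  ⟨ x , (λ e → y e - z e) ⟩  ≡⟨ ⟨⟩-distrib-- x y z ⟩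
  ⟨ x , y ⟩ - ⟨ x , z ⟩      ≡⟨ cong₂ _-_ (y⊥ x x∈X) (z⊥ x x∈X) ⟩
  0ℤ                         ∎

DualOn : ∀ {k} → (Fin k → Set) → (Fin k → C₁ k) → Set
DualOn I x = ∀ i i' → I i → I i' → ⟨ x i , edge i' ⟩ ≡ δ i i'

dualOn-entry : ∀ {k} {I : Fin k → Set} {x : Fin k → C₁ k} → DualOn I x →
               ∀ {i i'} → I i → I i' → x i i' ≡ edge i i'
dualOn-entry {x = x} dual {i} {i'} i∈I i'∈I = trans (sym (⟨-,edge⟩ (x i) i')) (dual i i' i∈I i'∈I)

record IsSubmodule {k} (P : C₁ k → Set) : Set where
  field
    respects-≐ : ∀ {x y} → x ≐ y → P x → P y
    zero∈      : P (λ _ → 0ℤ)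
    lincomb    : ∀ {l} (c : Fin l → ℤ) (x : Fin l → C₁ k) → (∀ i → P (x i)) →
                 P (λ e → Σ[< l ] (λ i → c i * x i e))

vanishes-by-dual-family :
  ∀ {k} {Q : C₁ k → Set} (T : Subset k) (x : Fin k → C₁ k) →
  (∀ e → e ∉ T → Q (x e)) → DualOn (_∉ T) x →
  ∀ z → (Q ⊥) z → (∀ t → t ∈ T → z t ≡ 0ℤ) → ∀ e → e ∉ T → z e ≡ 0ℤ
vanishes-by-dual-family {k} T x x∈Q dual z z⊥ z|T e e∉T = begin
  z e                                 ≡⟨ ⟨-,edge⟩ z e ⟨
  Σ[< k ] (λ e' → z e' * edge e e')   ≡⟨ Σ-cong k termwise ⟩
  ⟨ x e , z ⟩                         ≡⟨ z⊥ (x e) (x∈Q e e∉T) ⟩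
  0ℤ                                  ∎
  where
  termwise : ∀ e' → z e' * edge e e' ≡ x e e' * z e'
  termwise e' with e' ∈? T
  ... | yes e'∈T = begin
    z e' * edge e e'  ≡⟨ cong (_* edge e e') (z|T e' e'∈T) ⟩
    0ℤ * edge e e'    ≡⟨ *-zeroˡ (edge e e') ⟩
    0ℤ                ≡⟨ *-zeroʳ (x e e') ⟨
    x e e' * 0ℤ       ≡⟨ cong (x e e' *_) (z|T e' e'∈T) ⟨
    x e e' * z e'     ∎
  ... | no e'∉T = trans (*-comm (z e') (edge e e'))
                         (cong (_* z e') (sym (dualOn-entry {x = x} dual e∉T e'∉T)))

⊥⊆-of-dual-families :
  ∀ {k} {P Q : C₁ k → Set} (T : Subset k) → IsSubmodule P → (∀ y → P y → (Q ⊥) y) →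
  (xP : Fin k → C₁ k) → (∀ t → t ∈ T → P (xP t)) → DualOn (_∈ T) xP →
  (xQ : Fin k → C₁ k) → (∀ e → e ∉ T → Q (xQ e)) → DualOn (_∉ T) xQ →
  ∀ y → (Q ⊥) y → P y
⊥⊆-of-dual-families {k} {P} {Q} T P-sub P⊆Q⊥ xP xP∈P dualP xQ xQ∈Q dualQ y y⊥ =
  respects-≐ (λ e → sym (y≐b e)) b∈P
  where
  open IsSubmodule P-sub

  xP|T : Fin k → C₁ k
  xP|T t with t ∈? T
  ... | yes _ = xP t
  ... | no  _ = λ _ → 0ℤ

  xP|T∈P : ∀ t → P (xP|T t)
  xP|T∈P t with t ∈? T
  ... | yes t∈T = xP∈P t t∈T
  ... | no  _   = zero∈

  xP|T-on-T : ∀ t t' → t' ∈ T → xP|T t t' ≡ edge t t'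
  xP|T-on-T t t' t'∈T with t ∈? T
  ... | yes t∈T = dualOn-entry {x = xP} dualP t∈T t'∈T
  ... | no  t∉T = sym (edge-offdiag t t' λ { refl → t∉T t'∈T })

  b : C₁ k
  b e = Σ[< k ] (λ t → y t * xP|T t e)

  b∈P : P b
  b∈P = lincomb y xP|T xP|T∈P

  b-on-T : ∀ t' → t' ∈ T → b t' ≡ y t'
  b-on-T t' t'∈T = begin
    Σ[< k ] (λ t → y t * xP|T t t')  ≡⟨ Σ-cong k (λ t → cong (y t *_) (xP|T-on-T t t' t'∈T)) ⟩
    Σ[< k ] (λ t → y t * edge t t')  ≡⟨ Σ-cong k (λ t → cong (y t *_) (edge-sym t t')) ⟩
    ⟨ y , edge t' ⟩                  ≡⟨ ⟨-,edge⟩ y t' ⟩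
    y t'                             ∎

  z : C₁ k
  z e = y e - b e

  z-on-T : ∀ t → t ∈ T → z t ≡ 0ℤ
  z-on-T t t∈T = trans (cong (λ u → y t - u) (b-on-T t t∈T)) (+-inverseʳ (y t))

  z≐0 : ∀ e → z e ≡ 0ℤ
  z≐0 e with e ∈? T
  ... | yes e∈T = z-on-T e e∈T
  ... | no  e∉T = vanishes-by-dual-family T xQ xQ∈Q dualQ z
                    (⊥-closed-- Q y⊥ (P⊆Q⊥ b b∈P)) z-on-T e e∉T

  y≐b : y ≐ b
  y≐b e = i-j≡0⇒i≡j (y e) (b e) (z≐0 e)

module _ {n m : ℕ} (H : OrientedHypergraph n m) where

  private
    inc : Fin m → Fin n → ℤ
    inc = incidence H

  δ⁰-adjoint : ∀ φ y → ⟨ δ⁰ H φ , y ⟩ ≡ ⟨ φ , ∂₁ H y ⟩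
  δ⁰-adjoint φ y = begin
    Σ[< m ] (λ e → Σ[< n ] (λ v → φ v * inc e v) * y e)
      ≡⟨ Σ-cong m (λ e → Σ-*ʳ n (y e) _) ⟨
    Σ[< m ] (λ e → Σ[< n ] (λ v → φ v * inc e v * y e))
      ≡⟨ Σ-comm m n _ ⟩
    Σ[< n ] (λ v → Σ[< m ] (λ e → φ v * inc e v * y e))
      ≡⟨ Σ-cong n (λ v → Σ-cong m (λ e → reorder v e)) ⟩
    Σ[< n ] (λ v → Σ[< m ] (λ e → φ v * (y e * inc e v)))
      ≡⟨ Σ-cong n (λ v → Σ-*ˡ m (φ v) _) ⟩
    Σ[< n ] (λ v → φ v * ∂₁ H y v)
      ∎
    where
    reorder : ∀ v e → φ v * inc e v * y e ≡ φ v * (y e * inc e v)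
    reorder v e = trans (*-assoc (φ v) (inc e v) (y e)) (cong (φ v *_) (*-comm (inc e v) (y e)))

  δ⁰-lincomb : ∀ {l} (c : Fin l → ℤ) (φ : Fin l → C₀ n) e →
               δ⁰ H (λ v → Σ[< l ] (λ i → c i * φ i v)) e ≡ Σ[< l ] (λ i → c i * δ⁰ H (φ i) e)
  δ⁰-lincomb {l} c φ e = begin
    Σ[< n ] (λ v → Σ[< l ] (λ i → c i * φ i v) * inc e v)
      ≡⟨ Σ-cong n (λ v → Σ-*ʳ l (inc e v) _) ⟨
    Σ[< n ] (λ v → Σ[< l ] (λ i → c i * φ i v * inc e v))
      ≡⟨ Σ-comm n l _ ⟩
    Σ[< l ] (λ i → Σ[< n ] (λ v → c i * φ i v * inc e v))
      ≡⟨ Σ-cong l (λ i → Σ-cong n (λ v → *-assoc (c i) (φ i v) (inc e v))) ⟩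
    Σ[< l ] (λ i → Σ[< n ] (λ v → c i * (φ i v * inc e v)))
      ≡⟨ Σ-cong l (λ i → Σ-*ˡ n (c i) _) ⟩
    Σ[< l ] (λ i → c i * δ⁰ H (φ i) e)
      ∎

  ℬ-isSubmodule : IsSubmodule (ℬ H)
  ℬ-isSubmodule = record
    { respects-≐ = λ { x≐y (φ , x≐δφ) → φ , λ e → trans (sym (x≐y e)) (x≐δφ e) }
    ; zero∈      = (λ _ → 0ℤ) , λ e → sym (Σ-zero n (λ v → *-zeroˡ (inc e v)))
    ; lincomb    = λ c x x∈ℬ → (λ v → Σ[< _ ] (λ i → c i * proj₁ (x∈ℬ i) v))
                             , λ e → trans (Σ-cong _ (λ i → cong (c i *_) (proj₂ (x∈ℬ i) e)))
                                           (sym (δ⁰-lincomb c (proj₁ ∘ x∈ℬ) e))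
    }

  𝒞⊆ℬ⊥ : ∀ y → 𝒞 H y → (ℬ H ⊥) y
  𝒞⊆ℬ⊥ y ∂y≐0 x (φ , x≐δφ) = begin
    ⟨ x , y ⟩         ≡⟨ Σ-cong m (λ e → cong (_* y e) (x≐δφ e)) ⟩
    ⟨ δ⁰ H φ , y ⟩    ≡⟨ δ⁰-adjoint φ y ⟩
    ⟨ φ , ∂₁ H y ⟩    ≡⟨ Σ-zero n (λ v → trans (cong (φ v *_) (∂y≐0 v)) (*-zeroʳ (φ v))) ⟩
    0ℤ                ∎

  ℬ⊥⊆𝒞 : ∀ y → (ℬ H ⊥) y → 𝒞 H y
  ℬ⊥⊆𝒞 y y⊥ v = begin
    ∂₁ H y v                ≡⟨ ⟨edge,-⟩ v (∂₁ H y) ⟨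
    ⟨ edge v , ∂₁ H y ⟩     ≡⟨ δ⁰-adjoint (edge v) y ⟨
    ⟨ δ⁰ H (edge v) , y ⟩   ≡⟨ y⊥ (δ⁰ H (edge v)) (edge v , λ _ → refl) ⟩
    0ℤ                      ∎

  ℬ⊆𝒞⊥ : ∀ y → ℬ H y → (𝒞 H ⊥) y
  ℬ⊆𝒞⊥ y y∈ℬ x x∈𝒞 = trans (⟨⟩-comm x y) (𝒞⊆ℬ⊥ x x∈𝒞 y y∈ℬ)

  𝒞⊥⊆ℬ : (∃ λ (T : Subset m) → IsAlgebraicSpanningTree H T) → ∀ y → (𝒞 H ⊥) y → ℬ H y
  𝒞⊥⊆ℬ (T , (xB , (xB∈ℬ , _) , dualB) , (xC , (xC∈𝒞 , _) , dualC)) =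
    ⊥⊆-of-dual-families T ℬ-isSubmodule ℬ⊆𝒞⊥
      xB xB∈ℬ dualB xC (λ e e∉T → xC∈𝒞 e (x∉p⇒x∈∁p e∉T)) dualC

proposition12 : ∀ {n m : ℕ} (H : OrientedHypergraph n m) →
    (𝒞 H ≗ₛ (ℬ H ⊥))
    × ((∃ λ (T : Subset m) → IsAlgebraicSpanningTree H T) → ℬ H ≗ₛ (𝒞 H ⊥))
proposition12 H =
    (λ y → 𝒞⊆ℬ⊥ H y , ℬ⊥⊆𝒞 H y)
  , λ tree y → ℬ⊆𝒞⊥ H y , 𝒞⊥⊆ℬ H tree y
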